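{- For any partition $(A,B,W)$ of $V=\{0,1\}^n$ there is another partition $(A',B',W')$ of $V$ such that: (1) $\mu(A')=\mu(A)$, $\mu(B')=\mu(B)$, $\mu(W')=\mu(W)$; (2) $A'$ is increasing and $B'$ is decreasing; (3) $|\nabla_i(A,B)|\ge|\nabla_i(A',B')|$ for all $i\in[n]$.
   Context: $\mu$ is the uniform probability measure on $V=\{0,1\}^n$. $V$ carries the coordinatewise product order; $A\subseteq V$ is increasing if $x\in A$ and $y\ge x$ imply $y\in A$, and decreasing if $x\in A$ and $y\le x$ imply $y\in A$. For $x\in V$ and $i\in[n]$, $x^i$ is $x$ with its $i$th coordinate flipped, and for disjoint $A,B\subseteq V$, $\nabla_i(A,B)=\{(x,x^i): x\in A,\ x^i\in B\}$. -}

module Defs where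

open import Data.Bool using (Bool; true; false; not; T; T?)
import Data.Bool as B
open import Data.Nat using (ℕ; zero; suc; _^_)
open import Data.Nat.Properties using (m^n≢0)
open import Data.Integer using (+_)
open import Data.Rational using (ℚ; _/_)
open import Data.Fin using (Fin)
open import Data.Vec using (Vec; []; _∷_; _[_]%=_)
open import Data.Vec.Relation.Binary.Pointwise.Inductive using (Pointwise)
open import Data.List using (List; []; _∷_; _++_; map; filter; length)
open import Data.Product using (_×_)
open import Relation.Binary.PropositionalEquality using (_≡_)

-- The hypercube V = {0,1}^n, with 0 = false, 1 = true.
V : ℕ → Set
V n = Vec Bool n

Subset : ℕ → Set
Subset n = V n → Bool

allV : (n : ℕ) → List (V n)
allV zero = [] ∷ []
allV (suc n) = map (false ∷_) (allV n) ++ map (true ∷_) (allV n)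

card : ∀ {n} → Subset n → ℕ
card {n} A = length (filter (λ x → T? (A x)) (allV n))

μ : ∀ {n} → Subset n → ℚ
μ {n} A = (+ card A) / (2 ^ n)
  where instance _ = m^n≢0 2 n

_≤V_ : ∀ {n} → V n → V n → Set
_≤V_ = Pointwise B._≤_

Increasing : ∀ {n} → Subset n → Set
Increasing {n} A = (x y : V n) → T (A x) → x ≤V y → T (A y)

Decreasing : ∀ {n} → Subset n → Set
Decreasing {n} A = (x y : V n) → T (A x) → y ≤V x → T (A y)

flip : ∀ {n} → V n → Fin n → V n
flip x i = x [ i ]%= not

-- |∇_i(A,B)| = #{ (x, x^i) : x ∈ A, x^i ∈ B }  (pairs are determined by x).
∇card : ∀ {n} → Fin n → Subset n → Subset n → ℕ
∇card {n} i A B = length (filter (λ x → T? (A x B.∧ B (flip x i))) (allV n))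

-- (A,B,W) is a partition of V: every point lies in exactly one of the three
-- (parts may be empty).
data Exactly1 : Bool → Bool → Bool → Set where
  in₁ : Exactly1 true false false
  in₂ : Exactly1 false true false
  in₃ : Exactly1 false false true

IsPartition : ∀ {n} → Subset n → Subset n → Subset n → Set
IsPartition {n} A B W = (x : V n) → Exactly1 (A x) (B x) (W x)

-- Label each point 0, 1 or 2 according to whether it lies in B, W or A, and sort
-- this labelling along every coordinate in turn: replace the two values on each
-- edge in direction i by their minimum (at xᵢ = 0) and maximum (at xᵢ = 1). The
-- sorted labelling is monotone, so its level sets give A' increasing and B'
-- decreasing, and on each edge it only permutes the labels, so every class keeps
-- its size. The number of A–B edges in direction i is a sum of products
-- a(f x) b(f xⁱ) with a monotone and b antitone, and sorting an edge cannot
-- increase such a sum: this is the rearrangement inequality for two pairs.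
module Submission where

open import Defs
open import Data.Bool using (Bool; true; false; T; T?; _∧_)
open import Data.Fin using (Fin; zero; suc)
open import Data.Integer using (+_)
open import Data.Empty using (⊥-elim)
open import Data.List using ([]; _∷_; _++_; map; filter; length)
open import Data.List.Properties using (map-++; map-∘)
open import Data.Nat using (ℕ; zero; suc; _+_; _*_; _^_; _≤_; _⊓_; _⊔_; z≤n; s≤s)
open import Data.Nat.ListAction using (sum)
open import Data.Nat.ListAction.Properties using (sum-++)
open import Data.Nat.Properties
open import Data.Nat.Tactic.RingSolver using (solve-∀)
open import Data.Product using (Σ; _×_; _,_; proj₁; proj₂)
open import Data.Rational using (_/_)
open import Data.Sum using (inj₁; inj₂)
open import Data.Unit using (tt)
open import Data.Vec using ([]; _∷_)
open import Data.Vec.Relation.Binary.Pointwise.Inductive using ([]; _∷_)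
open import Function using (_∘_)
open import Relation.Binary.PropositionalEquality using (_≡_; refl; sym; trans; cong; cong₂; module ≡-Reasoning)

indicator : Bool → ℕ
indicator true  = 1
indicator false = 0

indicator-∧ : ∀ p q → indicator (p ∧ q) ≡ indicator p * indicator q
indicator-∧ true  q = sym (+-identityʳ (indicator q))
indicator-∧ false q = refl

indicator-mono : ∀ {p q} → (T p → T q) → indicator p ≤ indicator q
indicator-mono {false}         _    = z≤n
indicator-mono {true}  {true}  _    = ≤-refl
indicator-mono {true}  {false} p⇒q  = ⊥-elim (p⇒q tt)

sumV : ∀ n → (V n → ℕ) → ℕ
sumV zero    h = h []
sumV (suc n) h = sumV n (h ∘ (false ∷_)) + sumV n (h ∘ (true ∷_))

sumV-cong : ∀ n {h k : V n → ℕ} → (∀ x → h x ≡ k x) → sumV n h ≡ sumV n k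
sumV-cong zero    h≗k = h≗k []
sumV-cong (suc n) h≗k = cong₂ _+_ (sumV-cong n (h≗k ∘ (false ∷_))) (sumV-cong n (h≗k ∘ (true ∷_)))

sumV-mono : ∀ n {h k : V n → ℕ} → (∀ x → h x ≤ k x) → sumV n h ≤ sumV n k
sumV-mono zero    h≤k = h≤k []
sumV-mono (suc n) h≤k = +-mono-≤ (sumV-mono n (h≤k ∘ (false ∷_))) (sumV-mono n (h≤k ∘ (true ∷_)))

sumV-+ : ∀ n (h k : V n → ℕ) → sumV n (λ x → h x + k x) ≡ sumV n h + sumV n k
sumV-+ zero    h k = refl
sumV-+ (suc n) h k = trans
  (cong₂ _+_ (sumV-+ n (h ∘ (false ∷_)) (k ∘ (false ∷_))) (sumV-+ n (h ∘ (true ∷_)) (k ∘ (true ∷_))))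
  (+-+-interchange (sumV n (h ∘ (false ∷_))) _ _ _)
  where
  +-+-interchange : ∀ a b c d → (a + b) + (c + d) ≡ (a + c) + (b + d)
  +-+-interchange = solve-∀

sumV-+-mono : ∀ n {h k h′ k′ : V n → ℕ} → (∀ x → h x + k x ≤ h′ x + k′ x) →
              sumV n h + sumV n k ≤ sumV n h′ + sumV n k′
sumV-+-mono n {h} {k} {h′} {k′} pointwise = begin
  sumV n h + sumV n k              ≡⟨ sumV-+ n h k ⟨
  sumV n (λ x → h x + k x)         ≤⟨ sumV-mono n pointwise ⟩
  sumV n (λ x → h′ x + k′ x)       ≡⟨ sumV-+ n h′ k′ ⟩
  sumV n h′ + sumV n k′            ∎
  where open ≤-Reasoning

length-filter≡sum-map : ∀ {A : Set} (P : A → Bool) xs →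
                        length (filter (T? ∘ P) xs) ≡ sum (map (indicator ∘ P) xs)
length-filter≡sum-map P []       = refl
length-filter≡sum-map P (x ∷ xs) with P x
... | true  = cong suc (length-filter≡sum-map P xs)
... | false = length-filter≡sum-map P xs

sum-map-allV : ∀ n (h : V n → ℕ) → sum (map h (allV n)) ≡ sumV n h
sum-map-allV zero    h = +-identityʳ (h [])
sum-map-allV (suc n) h = begin
  sum (map h (map (false ∷_) (allV n) ++ map (true ∷_) (allV n)))
    ≡⟨ cong sum (map-++ h (map (false ∷_) (allV n)) _) ⟩
  sum (map h (map (false ∷_) (allV n)) ++ map h (map (true ∷_) (allV n)))
    ≡⟨ sum-++ (map h (map (false ∷_) (allV n))) _ ⟩
  sum (map h (map (false ∷_) (allV n))) + sum (map h (map (true ∷_) (allV n)))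
    ≡⟨ cong₂ (λ xs ys → sum xs + sum ys) (map-∘ (allV n)) (map-∘ (allV n)) ⟨
  sum (map (h ∘ (false ∷_)) (allV n)) + sum (map (h ∘ (true ∷_)) (allV n))
    ≡⟨ cong₂ _+_ (sum-map-allV n _) (sum-map-allV n _) ⟩
  sumV (suc n) h ∎
  where open ≡-Reasoning

card≡sumV : ∀ {n} (A : Subset n) → card A ≡ sumV n (indicator ∘ A)
card≡sumV {n} A = trans (length-filter≡sum-map A (allV n)) (sum-map-allV n (indicator ∘ A))

card-cong : ∀ {n} {A A′ : Subset n} → (∀ x → A x ≡ A′ x) → card A ≡ card A′
card-cong {n} {A} {A′} A≗A′ =
  trans (card≡sumV A) (trans (sumV-cong n (cong indicator ∘ A≗A′)) (sym (card≡sumV A′)))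

∇card≡sumV : ∀ {n} (i : Fin n) (A B : Subset n) →
             ∇card i A B ≡ sumV n (λ x → indicator (A x) * indicator (B (flip x i)))
∇card≡sumV {n} i A B =
  trans (card≡sumV (λ x → A x ∧ B (flip x i))) (sumV-cong n (λ x → indicator-∧ (A x) (B (flip x i))))

μ-cong : ∀ {n} {A A′ : Subset n} → card A ≡ card A′ → μ A ≡ μ A′
μ-cong {n} = cong (λ k → _/_ (+ k) (2 ^ n) {{m^n≢0 2 n}})

Monotone Antitone : (ℕ → ℕ) → Set
Monotone a = ∀ {m n} → m ≤ n → a m ≤ a n
Antitone b = ∀ {m n} → m ≤ n → b n ≤ b m

min₀ max₀ : ∀ {n} → (V (suc n) → ℕ) → V n → ℕ
min₀ f y = f (false ∷ y) ⊓ f (true ∷ y)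
max₀ f y = f (false ∷ y) ⊔ f (true ∷ y)

sort : ∀ n → (V n → ℕ) → V n → ℕ
sort zero    f = f
sort (suc n) f (false ∷ y) = sort n (min₀ f) y
sort (suc n) f (true  ∷ y) = sort n (max₀ f) y

sort-preserves-≤ : ∀ n {f g : V n → ℕ} → (∀ x → f x ≤ g x) → ∀ x → sort n f x ≤ sort n g x
sort-preserves-≤ zero    f≤g x = f≤g x
sort-preserves-≤ (suc n) f≤g (false ∷ y) =
  sort-preserves-≤ n (λ z → ⊓-mono-≤ (f≤g (false ∷ z)) (f≤g (true ∷ z))) y
sort-preserves-≤ (suc n) f≤g (true ∷ y) =
  sort-preserves-≤ n (λ z → ⊔-mono-≤ (f≤g (false ∷ z)) (f≤g (true ∷ z))) y

sort-monotone : ∀ n (f : V n → ℕ) {x y} → x ≤V y → sort n f x ≤ sort n f y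
sort-monotone zero    f []             = ≤-refl
sort-monotone (suc n) f {false ∷ _} {false ∷ _} (_ ∷ x≤y) = sort-monotone n (min₀ f) x≤y
sort-monotone (suc n) f {true  ∷ _} {true  ∷ _} (_ ∷ x≤y) = sort-monotone n (max₀ f) x≤y
sort-monotone (suc n) f {false ∷ _} {true  ∷ y} (_ ∷ x≤y) =
  ≤-trans (sort-monotone n (min₀ f) x≤y) (sort-preserves-≤ n (λ z → m⊓n≤m⊔n (f (false ∷ z)) (f (true ∷ z))) y)

⊓-⊔-symmetric : ∀ (h : ℕ → ℕ → ℕ) u v → h (u ⊓ v) (u ⊔ v) + h (u ⊔ v) (u ⊓ v) ≡ h u v + h v u
⊓-⊔-symmetric h u v with ≤-total u v
... | inj₁ u≤v rewrite m≤n⇒m⊓n≡m u≤v | m≤n⇒m⊔n≡n u≤v = refl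
... | inj₂ v≤u rewrite m≥n⇒m⊓n≡n v≤u | m≥n⇒m⊔n≡m v≤u = +-comm (h v u) (h u v)

sumV-sort : ∀ n (c : ℕ → ℕ) (f : V n → ℕ) → sumV n (c ∘ sort n f) ≡ sumV n (c ∘ f)
sumV-sort zero    c f = refl
sumV-sort (suc n) c f = begin
  sumV n (c ∘ sort n (min₀ f)) + sumV n (c ∘ sort n (max₀ f))
    ≡⟨ cong₂ _+_ (sumV-sort n c (min₀ f)) (sumV-sort n c (max₀ f)) ⟩
  sumV n (c ∘ min₀ f) + sumV n (c ∘ max₀ f)
    ≡⟨ sumV-+ n _ _ ⟨
  sumV n (λ y → c (min₀ f y) + c (max₀ f y))
    ≡⟨ sumV-cong n (λ y → ⊓-⊔-symmetric (λ u _ → c u) (f (false ∷ y)) (f (true ∷ y))) ⟩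
  sumV n (λ y → c (f (false ∷ y)) + c (f (true ∷ y)))
    ≡⟨ sumV-+ n _ _ ⟩
  sumV (suc n) (c ∘ f) ∎
  where open ≡-Reasoning

*-+-rearrangement : ∀ {x x′ y y′} → x ≤ x′ → y ≤ y′ → x * y′ + x′ * y ≤ x * y + x′ * y′
*-+-rearrangement {x} {y = y} x≤x′ y≤y′
  with d , refl ← m≤n⇒∃[o]m+o≡n x≤x′ | e , refl ← m≤n⇒∃[o]m+o≡n y≤y′ = begin
  x * (y + e) + (x + d) * y           ≤⟨ m≤m+n _ (d * e) ⟩
  x * (y + e) + (x + d) * y + d * e   ≡⟨ expand x y d e ⟩
  x * y + (x + d) * (y + e)           ∎
  where
  open ≤-Reasoning
  expand : ∀ x y d e → x * (y + e) + (x + d) * y + d * e ≡ x * y + (x + d) * (y + e)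
  expand = solve-∀

⊓-⊔-rearrangement : ∀ {a b} → Monotone a → Antitone b → ∀ u v w z →
                    a (u ⊓ v) * b (w ⊓ z) + a (u ⊔ v) * b (w ⊔ z) ≤ a u * b w + a v * b z
⊓-⊔-rearrangement {a} {b} a↑ b↓ u v w z with ≤-total u v | ≤-total w z
... | inj₁ u≤v | inj₁ w≤z
  rewrite m≤n⇒m⊓n≡m u≤v | m≤n⇒m⊔n≡n u≤v | m≤n⇒m⊓n≡m w≤z | m≤n⇒m⊔n≡n w≤z = ≤-refl
... | inj₁ u≤v | inj₂ z≤w
  rewrite m≤n⇒m⊓n≡m u≤v | m≤n⇒m⊔n≡n u≤v | m≥n⇒m⊓n≡n z≤w | m≥n⇒m⊔n≡m z≤w =
  *-+-rearrangement (a↑ u≤v) (b↓ z≤w)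
... | inj₂ v≤u | inj₁ w≤z
  rewrite m≥n⇒m⊓n≡n v≤u | m≥n⇒m⊔n≡m v≤u | m≤n⇒m⊓n≡m w≤z | m≤n⇒m⊔n≡n w≤z =
  ≤-trans (*-+-rearrangement (a↑ v≤u) (b↓ w≤z)) (≤-reflexive (+-comm (a v * b z) (a u * b w)))
... | inj₂ v≤u | inj₂ z≤w
  rewrite m≥n⇒m⊓n≡n v≤u | m≥n⇒m⊔n≡m v≤u | m≥n⇒m⊓n≡n z≤w | m≥n⇒m⊔n≡m z≤w =
  ≤-reflexive (+-comm (a v * b z) (a u * b w))

crossSum : ∀ n → (ℕ → ℕ) → (ℕ → ℕ) → (V n → ℕ) → (V n → ℕ) → ℕ
crossSum n a b f g = sumV n (λ x → a (f x) * b (g x))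

crossSum-sort : ∀ n {a b} → Monotone a → Antitone b → ∀ f g →
                crossSum n a b (sort n f) (sort n g) ≤ crossSum n a b f g
crossSum-sort zero    a↑ b↓ f g = ≤-refl
crossSum-sort (suc n) a↑ b↓ f g =
  ≤-trans (+-mono-≤ (crossSum-sort n a↑ b↓ (min₀ f) (min₀ g)) (crossSum-sort n a↑ b↓ (max₀ f) (max₀ g)))
          (sumV-+-mono n (λ y → ⊓-⊔-rearrangement a↑ b↓ (f (false ∷ y)) (f (true ∷ y)) (g (false ∷ y)) (g (true ∷ y))))

edgeSum : ∀ n → (ℕ → ℕ) → (ℕ → ℕ) → Fin n → (V n → ℕ) → ℕ
edgeSum n a b i f = crossSum n a b f (λ x → f (flip x i))

edgeSum-sort : ∀ n {a b} → Monotone a → Antitone b → ∀ i f →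
               edgeSum n a b i (sort n f) ≤ edgeSum n a b i f
edgeSum-sort (suc n) {a} {b} a↑ b↓ zero f =
  ≤-trans (+-mono-≤ (crossSum-sort n a↑ b↓ (min₀ f) (max₀ f)) (crossSum-sort n a↑ b↓ (max₀ f) (min₀ f)))
          (sumV-+-mono n (λ y → ≤-reflexive (⊓-⊔-symmetric (λ u v → a u * b v) (f (false ∷ y)) (f (true ∷ y)))))
edgeSum-sort (suc n) a↑ b↓ (suc j) f =
  ≤-trans (+-mono-≤ (edgeSum-sort n a↑ b↓ j (min₀ f)) (edgeSum-sort n a↑ b↓ j (max₀ f)))
          (sumV-+-mono n (λ y → ⊓-⊔-rearrangement a↑ b↓ (f (false ∷ y)) (f (true ∷ y))
                                                       (f (false ∷ flip y j)) (f (true ∷ flip y j))))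

label : Bool → Bool → ℕ
label true  _     = 2
label false true  = 0
label false false = 1

isA isB isW : ℕ → Bool
isA (suc (suc _)) = true
isA _             = false
isB zero          = true
isB _             = false
isW 1             = true
isW _             = false

label-correct : ∀ {a b w} → Exactly1 a b w → isA (label a b) ≡ a × isB (label a b) ≡ b × isW (label a b) ≡ w
label-correct in₁ = refl , refl , refl
label-correct in₂ = refl , refl , refl
label-correct in₃ = refl , refl , refl

classify-partition : ∀ l → Exactly1 (isA l) (isB l) (isW l)
classify-partition 0             = in₂
classify-partition 1             = in₃
classify-partition (suc (suc _)) = in₁

isA-mono : ∀ {m n} → m ≤ n → T (isA m) → T (isA n)
isA-mono (s≤s (s≤s _)) _ = tt

isB-antimono : ∀ {m n} → m ≤ n → T (isB n) → T (isB m)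
isB-antimono z≤n _ = tt

card-sort : ∀ n (g : ℕ → Bool) (f : V n → ℕ) → card (g ∘ sort n f) ≡ card (g ∘ f)
card-sort n g f =
  trans (card≡sumV (g ∘ sort n f)) (trans (sumV-sort n (indicator ∘ g) f) (sym (card≡sumV (g ∘ f))))

proposition3p4 : (n : ℕ) (A B W : Subset n) → IsPartition A B W →
    Σ (Subset n) λ A' → Σ (Subset n) λ B' → Σ (Subset n) λ W' →
      IsPartition A' B' W' ×
      (μ A' ≡ μ A × μ B' ≡ μ B × μ W' ≡ μ W) ×
      (Increasing A' × Decreasing B') ×
      ((i : Fin n) → ∇card i A' B' ≤ ∇card i A B)
proposition3p4 n A B W partition =
  isA ∘ F , isB ∘ F , isW ∘ F ,
  classify-partition ∘ F ,
  (μ-relabel isA A (proj₁ ∘ correct) ,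
   μ-relabel isB B (proj₁ ∘ proj₂ ∘ correct) ,
   μ-relabel isW W (proj₂ ∘ proj₂ ∘ correct)) ,
  ((λ x y x∈A' x≤y → isA-mono (sort-monotone n f x≤y) x∈A') ,
   (λ x y x∈B' y≤x → isB-antimono (sort-monotone n f y≤x) x∈B')) ,
  λ i → begin
    ∇card i (isA ∘ F) (isB ∘ F)  ≡⟨ ∇card≡sumV i (isA ∘ F) (isB ∘ F) ⟩
    edgeSum n 𝟙A 𝟙B i F         ≤⟨ edgeSum-sort n (indicator-mono ∘ isA-mono) (indicator-mono ∘ isB-antimono) i f ⟩
    edgeSum n 𝟙A 𝟙B i f         ≡⟨ sumV-cong n (λ x → cong₂ (λ a b → indicator a * indicator b)
                                      (proj₁ (correct x)) (proj₁ (proj₂ (correct (flip x i))))) ⟩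
    sumV n (λ x → indicator (A x) * indicator (B (flip x i)))  ≡⟨ ∇card≡sumV i A B ⟨
    ∇card i A B                 ∎
  where
  open ≤-Reasoning
  f : V n → ℕ
  f x = label (A x) (B x)
  F : V n → ℕ
  F = sort n f
  𝟙A 𝟙B : ℕ → ℕ
  𝟙A = indicator ∘ isA
  𝟙B = indicator ∘ isB
  correct : ∀ x → isA (f x) ≡ A x × isB (f x) ≡ B x × isW (f x) ≡ W x
  correct x = label-correct (partition x)
  μ-relabel : (g : ℕ → Bool) (X : Subset n) → (∀ x → g (f x) ≡ X x) → μ (g ∘ F) ≡ μ X
  μ-relabel g X g∘f≗X = μ-cong {n} (trans (card-sort n g f) (card-cong g∘f≗X))
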